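{- Let $p>5$ be a prime. Then \[ \sum_{k=1}^{p-1}k^4H_k^2\equiv \frac{5743}{27000}p-\frac{7}{225}\pmod{p^2}. \]
   Context: $H_n=\sum_{i=1}^n 1/i$ are the harmonic numbers. For rationals $a,b$ whose denominators are coprime to $p$, $a\equiv b\pmod{p^2}$ means that $a-b$, written in lowest terms, has numerator divisible by $p^2$. -}

module Defs where

open import Data.Nat as ℕ using (ℕ; zero; suc)
open import Data.Integer as ℤ using (ℤ; +_)
open import Data.Integer.Divisibility using () renaming (_∣_ to _∣ℤ_)
open import Data.Rational using (ℚ; ↥_; _+_; _*_; _-_; _/_; 0ℚ)

H : ℕ → ℚ
H zero = 0ℚ
H (suc n) = H n + (+ 1) / suc n

sumFrom1 : ℕ → (ℕ → ℚ) → ℚ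
sumFrom1 zero f = 0ℚ
sumFrom1 (suc n) f = sumFrom1 n f + f (suc n)

nℚ : ℕ → ℚ
nℚ n = (+ n) / 1

-- a ≡ b (mod m) for rationals: the numerator of a - b in lowest terms
-- (ℚ is always normalised) is divisible by m.
_≡ℚ_[mod_] : ℚ → ℚ → ℕ → Set
a ≡ℚ b [mod m ] = (+ m) ∣ℤ (↥ (a - b))

module Submission where

-- Write p = 2m + 1 and N = p − 1, and call a rational p-integral when p does not
-- divide its reduced denominator.  The proof has three ingredients.
--  * Closed form: Σ_{k≤n} k⁴H_k² = a(n)H_n² + b(n)H_n + c(n) for explicit
--    polynomials a, b, c; by induction, each step being a polynomial identity
--    (verified by the ring solver) that holds whenever x·(n + 1) = 1.
--  * Wolstenholme: H_N = p²·Y with Y p-integral.  Pairing j with p − j gives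
--    2H_N = p(−T + p·Y₁) with T = Σ_{j≤N} 1/j²; splitting T into halves, and into
--    even and odd terms, shows T ≡ 2V and T ≡ V/2 (mod p), V = Σ_{j≤m} 1/j², so
--    T ≡ 0 (mod p) as p ≠ 3.
--  * Substituting H_N = p²Y into the closed form, the difference with the claimed
--    value is p²·Z(N, Y), where Z is a polynomial whose coefficients have
--    denominators dividing 30⁶; so Z is p-integral, and p² divides the numerator
--    of p²·Z.

open import Defs
open import Data.Nat using (ℕ; _>_; _^_; _∸_)
open import Data.Nat.Primality using (Prime)
open import Data.Integer using (+_)
open import Data.Rational using (_*_; _-_; _/_)

open import Data.Nat as ℕ using (zero; suc; z≤n; s≤s)
import Data.Nat.Properties as ℕP
import Data.Nat.Coprimality as C
open import Data.Nat.Divisibility using (_∣_; _∣?_; divides; ∣-trans; ∣⇒≤; 1∣_; m*n∣⇒m∣; *-monoˡ-∣; *-cancelˡ-∣)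
open import Data.Nat.Primality using (euclidsLemma; prime⇒nonZero; prime⇒nonTrivial; prime⇒irreducible)
open import Data.Sum using (_⊎_; inj₁; inj₂; [_,_]′)
open import Data.Empty using (⊥-elim)
open import Relation.Nullary using (¬_)
open import Function using (_∘_)
open import Data.Product using (Σ; _×_; _,_; proj₁; proj₂)
open import Data.List.Relation.Unary.All as All using (All; []; _∷_; all?)
open import Relation.Nullary.Decidable using (True; toWitness)
import Data.Integer as ℤ
import Data.Integer.Properties as ℤP
open import Data.Rational using (ℚ; mkℚ; ↥_; ↧_; ↧ₙ_; _+_; -_; 0ℚ; 1ℚ; toℚᵘ)
open import Data.Rational.Properties
  using (normalize-coprime; toℚᵘ-injective; toℚᵘ-homo-+; toℚᵘ-homo-*;
         +-comm; +-assoc; +-identityʳ; *-zeroʳ; *-distribˡ-+; neg-distrib-+; *-assoc; ↥-*; ↧-+; ↧-*; ↧-neg)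
import Data.Rational.Unnormalised as U
import Data.Rational.Unnormalised.Properties as UP
open import Data.Rational.Solver using (module +-*-Solver)
open import Relation.Binary.PropositionalEquality
open import Data.List using (List; []; _∷_)

open +-*-Solver using (solve; Polynomial; con; _:+_; _:*_; _:-_; :-_; _:=_)

nℚ-normal : ∀ n → nℚ n ≡ mkℚ (+ n) 0 (C.sym (C.1-coprimeTo n))
nℚ-normal n = normalize-coprime (C.sym (C.1-coprimeTo n))

↥-nℚ : ∀ n → ↥ (nℚ n) ≡ + n
↥-nℚ n = cong ↥_ (nℚ-normal n)

↧-nℚ : ∀ n → ↧ (nℚ n) ≡ + 1
↧-nℚ n = cong ↧_ (nℚ-normal n)

nℚ-toℚᵘ : ∀ n → toℚᵘ (nℚ n) ≡ U.mkℚᵘ (+ n) 0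
nℚ-toℚᵘ n = cong toℚᵘ (nℚ-normal n)

nℚ-+ : ∀ a b → nℚ (a ℕ.+ b) ≡ nℚ a + nℚ b
nℚ-+ a b = toℚᵘ-injective (begin
  toℚᵘ (nℚ (a ℕ.+ b))                ≡⟨ nℚ-toℚᵘ (a ℕ.+ b) ⟩
  U.mkℚᵘ (+ (a ℕ.+ b)) 0              ≈⟨ U.*≡* (cong (ℤ._* + 1) (trans (ℤP.pos-+ a b) unit-factors)) ⟩
  U.mkℚᵘ (+ a) 0 U.+ U.mkℚᵘ (+ b) 0  ≡⟨ sym (cong₂ U._+_ (nℚ-toℚᵘ a) (nℚ-toℚᵘ b)) ⟩
  toℚᵘ (nℚ a) U.+ toℚᵘ (nℚ b)        ≈⟨ UP.≃-sym (toℚᵘ-homo-+ (nℚ a) (nℚ b)) ⟩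
  toℚᵘ (nℚ a + nℚ b)                 ∎)
  where
  open UP.≃-Reasoning
  unit-factors : + a ℤ.+ + b ≡ + a ℤ.* + 1 ℤ.+ + b ℤ.* + 1
  unit-factors = sym (cong₂ ℤ._+_ (ℤP.*-identityʳ (+ a)) (ℤP.*-identityʳ (+ b)))

nℚ-* : ∀ a b → nℚ (a ℕ.* b) ≡ nℚ a * nℚ b
nℚ-* a b = toℚᵘ-injective (begin
  toℚᵘ (nℚ (a ℕ.* b))                ≡⟨ nℚ-toℚᵘ (a ℕ.* b) ⟩
  U.mkℚᵘ (+ (a ℕ.* b)) 0              ≈⟨ U.*≡* (cong (ℤ._* + 1) (ℤP.pos-* a b)) ⟩
  U.mkℚᵘ (+ a) 0 U.* U.mkℚᵘ (+ b) 0  ≡⟨ sym (cong₂ U._*_ (nℚ-toℚᵘ a) (nℚ-toℚᵘ b)) ⟩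
  toℚᵘ (nℚ a) U.* toℚᵘ (nℚ b)        ≈⟨ UP.≃-sym (toℚᵘ-homo-* (nℚ a) (nℚ b)) ⟩
  toℚᵘ (nℚ a * nℚ b)                 ∎)
  where open UP.≃-Reasoning

nℚ-suc : ∀ n → nℚ (suc n) ≡ nℚ n + 1ℚ
nℚ-suc n = trans (cong nℚ (ℕP.+-comm 1 n)) (nℚ-+ n 1)

nℚ-square : ∀ n z → nℚ n * (nℚ n * z) ≡ nℚ (n ^ 2) * z
nℚ-square n z = begin
  nℚ n * (nℚ n * z)            ≡⟨ *-assoc (nℚ n) (nℚ n) z ⟨
  nℚ n * nℚ n * z              ≡⟨ cong (λ k → nℚ n * nℚ k * z) (ℕP.*-identityʳ n) ⟨
  nℚ n * nℚ (n ℕ.* 1) * z      ≡⟨ cong (_* z) (nℚ-* n (n ℕ.* 1)) ⟨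
  nℚ (n ^ 2) * z               ∎
  where open ≡-Reasoning

recip : ℕ → ℚ
recip zero = 0ℚ
recip (suc k) = (+ 1) / suc k

recip-inverse : ∀ k .{{_ : ℕ.NonZero k}} → recip k * nℚ k ≡ 1ℚ
recip-inverse (suc k) = toℚᵘ-injective (begin
  toℚᵘ (recip (suc k) * nℚ (suc k))           ≈⟨ toℚᵘ-homo-* (recip (suc k)) (nℚ (suc k)) ⟩
  toℚᵘ (recip (suc k)) U.* toℚᵘ (nℚ (suc k))  ≡⟨ cong₂ U._*_ recip-toℚᵘ (nℚ-toℚᵘ (suc k)) ⟩
  U.mkℚᵘ (+ 1) k U.* U.mkℚᵘ (+ suc k) 0       ≈⟨ U.*≡* cross-multiplied ⟩
  toℚᵘ 1ℚ                                     ∎)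
  where
  open UP.≃-Reasoning
  recip-toℚᵘ : toℚᵘ (recip (suc k)) ≡ U.mkℚᵘ (+ 1) k
  recip-toℚᵘ = cong toℚᵘ (normalize-coprime (C.1-coprimeTo (suc k)))
  cross-multiplied : (+ 1 ℤ.* + suc k) ℤ.* + 1 ≡ + 1 ℤ.* + (suc k ℕ.* 1)
  cross-multiplied = trans (ℤP.*-identityʳ _) (cong (λ d → + 1 ℤ.* + d) (sym (ℕP.*-identityʳ (suc k))))

H-as-sum : ∀ n → H n ≡ sumFrom1 n recip
H-as-sum zero = refl
H-as-sum (suc n) = cong (_+ recip (suc n)) (H-as-sum n)

sum-cong : ∀ n {f g : ℕ → ℚ} → (∀ k → k ℕ.< n → f (suc k) ≡ g (suc k)) →
           sumFrom1 n f ≡ sumFrom1 n g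
sum-cong zero eq = refl
sum-cong (suc n) eq = cong₂ _+_ (sum-cong n (λ k k<n → eq k (ℕP.m<n⇒m<1+n k<n))) (eq n ℕP.≤-refl)

sum-+ : ∀ n (f g : ℕ → ℚ) → sumFrom1 n (λ k → f k + g k) ≡ sumFrom1 n f + sumFrom1 n g
sum-+ zero f g = refl
sum-+ (suc n) f g = trans (cong (_+ (f (suc n) + g (suc n))) (sum-+ n f g))
  (solve 4 (λ a b c d → (a :+ b) :+ (c :+ d) := (a :+ c) :+ (b :+ d)) refl
    (sumFrom1 n f) (sumFrom1 n g) (f (suc n)) (g (suc n)))

sum-scale : ∀ n c (f : ℕ → ℚ) → sumFrom1 n (λ k → c * f k) ≡ c * sumFrom1 n f
sum-scale zero c f = sym (*-zeroʳ c)
sum-scale (suc n) c f = trans (cong (_+ c * f (suc n)) (sum-scale n c f))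
  (sym (*-distribˡ-+ c (sumFrom1 n f) (f (suc n))))

sum-neg : ∀ n (f : ℕ → ℚ) → sumFrom1 n (λ k → - f k) ≡ - sumFrom1 n f
sum-neg zero f = refl
sum-neg (suc n) f = trans (cong (_+ - f (suc n)) (sum-neg n f))
  (sym (neg-distrib-+ (sumFrom1 n f) (f (suc n))))

sum-linear : ∀ n c {f g h : ℕ → ℚ} → (∀ k → k ℕ.< n → f (suc k) ≡ g (suc k) + c * h (suc k)) →
             sumFrom1 n f ≡ sumFrom1 n g + c * sumFrom1 n h
sum-linear n c {f} {g} {h} eq = begin
  sumFrom1 n f                               ≡⟨ sum-cong n eq ⟩
  sumFrom1 n (λ k → g k + c * h k)           ≡⟨ sum-+ n g (λ k → c * h k) ⟩
  sumFrom1 n g + sumFrom1 n (λ k → c * h k)  ≡⟨ cong (_+_ (sumFrom1 n g)) (sum-scale n c h) ⟩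
  sumFrom1 n g + c * sumFrom1 n h            ∎
  where open ≡-Reasoning

sum-first : ∀ n (f : ℕ → ℚ) → sumFrom1 (suc n) f ≡ f 1 + sumFrom1 n (λ j → f (suc j))
sum-first zero f = +-comm 0ℚ (f 1)
sum-first (suc n) f = trans (cong (_+ f (suc (suc n))) (sum-first n f))
  (+-assoc (f 1) (sumFrom1 n (λ j → f (suc j))) (f (suc (suc n))))

sum-reverse : ∀ n (f : ℕ → ℚ) → sumFrom1 n f ≡ sumFrom1 n (λ j → f (suc n ∸ j))
sum-reverse zero f = refl
sum-reverse (suc n) f = begin
  sumFrom1 n f + f (suc n)                         ≡⟨ cong (_+ f (suc n)) (sum-reverse n f) ⟩
  sumFrom1 n (λ j → f (suc n ∸ j)) + f (suc n)     ≡⟨ +-comm _ (f (suc n)) ⟩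
  f (suc n) + sumFrom1 n (λ j → f (suc n ∸ j))     ≡⟨ sum-first n (λ j → f (suc (suc n) ∸ j)) ⟨
  sumFrom1 (suc n) (λ j → f (suc (suc n) ∸ j))     ∎
  where open ≡-Reasoning

sum-append : ∀ a b (f : ℕ → ℚ) → sumFrom1 (a ℕ.+ b) f ≡ sumFrom1 a f + sumFrom1 b (λ j → f (a ℕ.+ j))
sum-append a zero f rewrite ℕP.+-identityʳ a = sym (+-identityʳ (sumFrom1 a f))
sum-append a (suc b) f rewrite ℕP.+-suc a b = trans (cong (_+ f (suc (a ℕ.+ b))) (sum-append a b f))
  (+-assoc (sumFrom1 a f) (sumFrom1 b (λ j → f (a ℕ.+ j))) (f (suc (a ℕ.+ b))))

sum-halves : ∀ m (f : ℕ → ℚ) →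
             sumFrom1 (m ℕ.+ m) f ≡ sumFrom1 m f + sumFrom1 m (λ j → f (suc (m ℕ.+ m) ∸ j))
sum-halves m f = begin
  sumFrom1 (m ℕ.+ m) f                                   ≡⟨ sum-append m m f ⟩
  sumFrom1 m f + sumFrom1 m (λ j → f (m ℕ.+ j))           ≡⟨ cong (_+_ (sumFrom1 m f)) (sum-reverse m _) ⟩
  sumFrom1 m f + sumFrom1 m (λ j → f (m ℕ.+ (suc m ∸ j))) ≡⟨ cong (_+_ (sumFrom1 m f)) (sum-cong m reflected) ⟩
  sumFrom1 m f + sumFrom1 m (λ j → f (suc (m ℕ.+ m) ∸ j)) ∎
  where
  open ≡-Reasoning
  reflected : ∀ k → k ℕ.< m → f (m ℕ.+ (m ∸ k)) ≡ f ((m ℕ.+ m) ∸ k)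
  reflected k k<m = cong f (sym (ℕP.+-∸-assoc m (ℕP.<⇒≤ k<m)))

sum-parity : ∀ m (f : ℕ → ℚ) →
             sumFrom1 (m ℕ.+ m) f ≡ sumFrom1 m (λ j → f (j ℕ.+ j)) + sumFrom1 m (λ j → f (suc (m ℕ.+ m) ∸ (j ℕ.+ j)))
sum-parity zero f = refl
sum-parity (suc m) f = begin
  sumFrom1 (suc m ℕ.+ suc m) f           ≡⟨ cong (λ n → sumFrom1 n f) (ℕP.+-suc (suc m) m) ⟩
  sumFrom1 (m ℕ.+ m) f + odd + even      ≡⟨ cong (λ s → s + odd + even) (sum-parity m f) ⟩
  Evens + Odds + odd + even              ≡⟨ solve 4 (λ e o x y → e :+ o :+ x :+ y := e :+ y :+ (x :+ o)) refl Evens Odds odd even ⟩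
  Evens + even + (odd + Odds)            ≡⟨ cong₂ (λ y s → Evens + y + s) (cong f (sym (ℕP.+-suc (suc m) m)))
                                                (cong₂ _+_ (cong f (sym (ℕP.+-suc m m))) (sum-cong m λ j _ → cong f (sym (reflect j)))) ⟩
  sumFrom1 (suc m) (λ j → f (j ℕ.+ j)) + (Odd 1 + sumFrom1 m (λ j → Odd (suc j)))
                                         ≡⟨ cong (_+_ (sumFrom1 (suc m) (λ j → f (j ℕ.+ j)))) (sum-first m Odd) ⟨
  sumFrom1 (suc m) (λ j → f (j ℕ.+ j)) + sumFrom1 (suc m) Odd ∎
  where
  open ≡-Reasoning
  Odd : ℕ → ℚ
  Odd j = f (suc (suc m ℕ.+ suc m) ∸ (j ℕ.+ j))
  odd even Evens Odds : ℚ
  odd = f (suc (m ℕ.+ m))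
  even = f (suc (suc (m ℕ.+ m)))
  Evens = sumFrom1 m (λ j → f (j ℕ.+ j))
  Odds = sumFrom1 m (λ j → f (suc (m ℕ.+ m) ∸ (j ℕ.+ j)))
  reflect : ∀ j → suc (suc m ℕ.+ suc m) ∸ (suc (suc j) ℕ.+ suc (suc j)) ≡ suc (m ℕ.+ m) ∸ (suc j ℕ.+ suc j)
  reflect j = cong₂ (λ a b → suc a ∸ b) (ℕP.+-suc m m) (ℕP.+-suc (suc j) (suc j))

-- Polynomials with rational coefficients, as coefficient lists (constant term
-- first) evaluated by Horner's rule.  hornerS is the same evaluation on the
-- ring solver's expressions; its meaning is definitionally horner, which lets
-- the solver verify identities between such polynomials.
horner : List ℚ → ℚ → ℚ
horner [] t = 0ℚ
horner (c ∷ cs) t = c + t * horner cs t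

hornerS : ∀ {m} → List ℚ → Polynomial m → Polynomial m
hornerS [] t = con 0ℚ
hornerS (c ∷ cs) t = con c :+ t :* hornerS cs t

aCoeffs bCoeffs cCoeffs : List ℚ
aCoeffs = 0ℚ ∷ - (+ 1 / 30) ∷ 0ℚ ∷ + 1 / 3 ∷ + 1 / 2 ∷ + 1 / 5 ∷ []
bCoeffs = + 1 / 30 ∷ - (+ 7 / 225) ∷ - (+ 1 / 12) ∷ + 13 / 90 ∷ + 1 / 20 ∷ - (+ 2 / 25) ∷ []
cCoeffs = 0ℚ ∷ - (+ 1007 / 27000) ∷ - (+ 7 / 720) ∷ + 109 / 5400 ∷ - (+ 9 / 400) ∷ + 2 / 125 ∷ []

closedForm : ℚ → ℚ → ℚ
closedForm n h = horner aCoeffs n * h * h + horner bCoeffs n * h + horner cCoeffs n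

closedFormS : ∀ {m} → Polynomial m → Polynomial m → Polynomial m
closedFormS n h = hornerS aCoeffs n :* h :* h :+ hornerS bCoeffs n :* h :+ hornerS cCoeffs n

-- The step n → n + 1 with h ↦ h + x, as a polynomial identity: the defect is a
-- multiple of x(n + 1) − 1, with cofactor g₀(n) + g₁(n)(x + 2h).
g₀Coeffs g₁Coeffs : List ℚ
g₀Coeffs = - (+ 1 / 30) ∷ + 7 / 225 ∷ + 77 / 900 ∷ + 7 / 100 ∷ + 2 / 25 ∷ []
g₁Coeffs = 0ℚ ∷ + 1 / 30 ∷ - (+ 1 / 30) ∷ - (+ 3 / 10) ∷ - (+ 1 / 5) ∷ []

closedForm-step-identity : ∀ n h x →
  closedForm n h + (n + 1ℚ) * (n + 1ℚ) * (n + 1ℚ) * (n + 1ℚ) * (h + x) * (h + x)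
    ≡ closedForm (n + 1ℚ) (h + x)
      + (x * (n + 1ℚ) - 1ℚ) * (horner g₀Coeffs n + horner g₁Coeffs n * (x + h + h))
closedForm-step-identity = solve 3 (λ n h x →
  closedFormS n h :+ (n :+ con 1ℚ) :* (n :+ con 1ℚ) :* (n :+ con 1ℚ) :* (n :+ con 1ℚ) :* (h :+ x) :* (h :+ x)
    := closedFormS (n :+ con 1ℚ) (h :+ x)
       :+ (x :* (n :+ con 1ℚ) :- con 1ℚ) :* (hornerS g₀Coeffs n :+ hornerS g₁Coeffs n :* (x :+ h :+ h))) refl

closedForm-step : ∀ n h x → x * (n + 1ℚ) ≡ 1ℚ →
  closedForm n h + (n + 1ℚ) * (n + 1ℚ) * (n + 1ℚ) * (n + 1ℚ) * (h + x) * (h + x) ≡ closedForm (n + 1ℚ) (h + x)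
closedForm-step n h x inverse = begin
  closedForm n h + (n + 1ℚ) * (n + 1ℚ) * (n + 1ℚ) * (n + 1ℚ) * (h + x) * (h + x)
                                                        ≡⟨ closedForm-step-identity n h x ⟩
  closedForm (n + 1ℚ) (h + x) + (x * (n + 1ℚ) - 1ℚ) * G  ≡⟨ cong (λ t → closedForm (n + 1ℚ) (h + x) + (t - 1ℚ) * G) inverse ⟩
  closedForm (n + 1ℚ) (h + x) + (1ℚ - 1ℚ) * G            ≡⟨ solve 2 (λ a g → a :+ (con 1ℚ :- con 1ℚ) :* g := a) refl _ G ⟩
  closedForm (n + 1ℚ) (h + x)                            ∎
  where
  open ≡-Reasoning
  G : ℚ
  G = horner g₀Coeffs n + horner g₁Coeffs n * (x + h + h)

k⁴H² : ℕ → ℚ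
k⁴H² k = nℚ k * nℚ k * nℚ k * nℚ k * H k * H k

sum-k⁴H² : ∀ N → sumFrom1 N k⁴H² ≡ closedForm (nℚ N) (H N)
sum-k⁴H² zero = refl
sum-k⁴H² (suc N) = begin
  sumFrom1 N k⁴H² + k⁴H² (suc N)                    ≡⟨ cong (_+ k⁴H² (suc N)) (sum-k⁴H² N) ⟩
  closedForm n (H N) + k⁴H² (suc N)                  ≡⟨ cong (λ w → closedForm n (H N) + w * w * w * w * H (suc N) * H (suc N)) (nℚ-suc N) ⟩
  closedForm n (H N) + (n + 1ℚ) * (n + 1ℚ) * (n + 1ℚ) * (n + 1ℚ) * H (suc N) * H (suc N)
                                                     ≡⟨ closedForm-step n (H N) (recip (suc N)) inverse ⟩
  closedForm (n + 1ℚ) (H (suc N))                    ≡⟨ cong (λ w → closedForm w (H (suc N))) (nℚ-suc N) ⟨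
  closedForm (nℚ (suc N)) (H (suc N))                ∎
  where
  open ≡-Reasoning
  n : ℚ
  n = nℚ N
  inverse : recip (suc N) * (n + 1ℚ) ≡ 1ℚ
  inverse = trans (cong (recip (suc N) *_) (sym (nℚ-suc N))) (recip-inverse (suc N))

abs-∣ : ∀ (d g b : ℤ.ℤ) → d ℤ.* g ≡ b → ℤ.∣ d ∣ ∣ ℤ.∣ b ∣
abs-∣ d g b eq = divides ℤ.∣ g ∣ (trans (cong ℤ.∣_∣ (sym eq)) (trans (ℤP.abs-* d g) (ℕP.*-comm ℤ.∣ d ∣ ℤ.∣ g ∣)))

↧ₙ-+-∣ : ∀ x y → ↧ₙ (x + y) ∣ ↧ₙ x ℕ.* ↧ₙ y
↧ₙ-+-∣ x y = subst (↧ₙ (x + y) ∣_) (ℤP.abs-* (↧ x) (↧ y)) (abs-∣ (↧ (x + y)) _ _ (↧-+ x y))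

↧ₙ-*-∣ : ∀ x y → ↧ₙ (x * y) ∣ ↧ₙ x ℕ.* ↧ₙ y
↧ₙ-*-∣ x y = subst (↧ₙ (x * y) ∣_) (ℤP.abs-* (↧ x) (↧ y)) (abs-∣ (↧ (x * y)) _ _ (↧-* x y))

module Integrality {p : ℕ} (p-prime : Prime p) where

  instance
    p≢0 : ℕ.NonZero p
    p≢0 = prime⇒nonZero p-prime

  -- (A record rather than a function, so that x is inferable from Integral x.)
  record Integral (x : ℚ) : Set where
    constructor integral
    field p∤↧ : ¬ p ∣ ↧ₙ x

  ∤-* : ∀ {a b} → ¬ p ∣ a → ¬ p ∣ b → ¬ p ∣ a ℕ.* b
  ∤-* {a} {b} p∤a p∤b p∣ab = [ p∤a , p∤b ]′ (euclidsLemma a b p-prime p∣ab)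

  ∤-small : ∀ n .{{_ : ℕ.NonZero n}} → n ℕ.< p → ¬ p ∣ n
  ∤-small n n<p p∣n = ℕP.<⇒≱ n<p (∣⇒≤ p∣n)

  ∤1 : ¬ p ∣ 1
  ∤1 = ∤-small 1 (ℕ.nonTrivial⇒n>1 p {{prime⇒nonTrivial p-prime}})

  integral-+ : ∀ {x y} → Integral x → Integral y → Integral (x + y)
  integral-+ {x} {y} (integral ix) (integral iy) = integral λ p∣ → ∤-* ix iy (∣-trans p∣ (↧ₙ-+-∣ x y))

  integral-* : ∀ {x y} → Integral x → Integral y → Integral (x * y)
  integral-* {x} {y} (integral ix) (integral iy) = integral λ p∣ → ∤-* ix iy (∣-trans p∣ (↧ₙ-*-∣ x y))

  integral-neg : ∀ {x} → Integral x → Integral (- x)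
  integral-neg {x} (integral ix) = integral (ix ∘ subst (p ∣_) (cong ℤ.∣_∣ (↧-neg x)))

  integral-nℚ : ∀ n → Integral (nℚ n)
  integral-nℚ n rewrite nℚ-normal n = integral ∤1

  integral-0 : Integral 0ℚ
  integral-0 = integral-nℚ 0

  integral-recip : ∀ k → k ℕ.< p → Integral (recip k)
  integral-recip zero _ = integral-0
  integral-recip (suc k) k<p rewrite normalize-coprime (C.1-coprimeTo (suc k)) = integral (∤-small (suc k) k<p)

  integral-sum : ∀ n {f : ℕ → ℚ} → (∀ k → k ℕ.< n → Integral (f (suc k))) → Integral (sumFrom1 n f)
  integral-sum zero _ = integral-0
  integral-sum (suc n) i = integral-+ (integral-sum n (λ k k<n → i k (ℕP.m<n⇒m<1+n k<n))) (i n ℕP.≤-refl)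

  integral-horner : ∀ {cs t} → All Integral cs → Integral t → Integral (horner cs t)
  integral-horner [] _ = integral-0
  integral-horner (ic ∷ ics) it = integral-+ ic (integral-* it (integral-horner ics it))

  ∤30^ : p > 5 → ∀ k → ¬ p ∣ 30 ^ k
  ∤30^ p>5 zero = ∤1
  ∤30^ p>5 (suc k) = ∤-* ∤30 (∤30^ p>5 k)
    where
    ∤≤5 : ∀ n .{{_ : ℕ.NonZero n}} → n ℕ.≤ 5 → ¬ p ∣ n
    ∤≤5 n n≤5 = ∤-small n (ℕP.≤-<-trans n≤5 p>5)
    ∤30 : ¬ p ∣ 2 ℕ.* (3 ℕ.* 5)
    ∤30 = ∤-* (∤≤5 2 (s≤s (s≤s z≤n))) (∤-* (∤≤5 3 (s≤s (s≤s (s≤s z≤n)))) (∤≤5 5 ℕP.≤-refl))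

  integral-30-smooth : p > 5 → ∀ {k} c → ↧ₙ c ∣ 30 ^ k → Integral c
  integral-30-smooth p>5 {k} c ↧c∣30ᵏ = integral λ p∣↧c → ∤30^ p>5 k (∣-trans p∣↧c ↧c∣30ᵏ)

  ∣-cancel : ∀ k {X g} → ¬ p ∣ g → p ^ k ∣ X ℕ.* g → p ^ k ∣ X
  ∣-cancel zero {X} _ _ = 1∣ X
  ∣-cancel (suc k) {X} {g} p∤g pᵏ⁺¹∣Xg with euclidsLemma X g p-prime (m*n∣⇒m∣ p (p ^ k) pᵏ⁺¹∣Xg)
  ... | inj₂ p∣g = ⊥-elim (p∤g p∣g)
  ... | inj₁ (divides s refl) = subst (_∣ s ℕ.* p) (ℕP.*-comm (p ^ k) p) (*-monoˡ-∣ p pᵏ∣s)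
    where
    reassociate : s ℕ.* p ℕ.* g ≡ p ℕ.* (s ℕ.* g)
    reassociate = trans (cong (ℕ._* g) (ℕP.*-comm s p)) (ℕP.*-assoc p s g)
    pᵏ∣s : p ^ k ∣ s
    pᵏ∣s = ∣-cancel k p∤g (*-cancelˡ-∣ p (subst (p ^ suc k ∣_) reassociate pᵏ⁺¹∣Xg))

  -- The numerator
  -- and denominator of p^k·z are those of the fraction (p^k·↥z)/↧z divided by a
  -- common factor g; g divides ↧z, so it is prime to p and can be cancelled.
  p^k∣numerator : ∀ k {z} → Integral z → p ^ k ∣ ℤ.∣ ↥ (nℚ (p ^ k) * z) ∣
  p^k∣numerator k {z} (integral p∤↧z) = cancel-common-factor (↥-* (nℚ (p ^ k)) z) (↧-* (nℚ (p ^ k)) z)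
    where
    x : ℚ
    x = nℚ (p ^ k) * z
    cancel-common-factor : ∀ {g} → ↥ x ℤ.* g ≡ ↥ (nℚ (p ^ k)) ℤ.* ↥ z → ↧ x ℤ.* g ≡ ↧ (nℚ (p ^ k)) ℤ.* ↧ z →
                           p ^ k ∣ ℤ.∣ ↥ x ∣
    cancel-common-factor {g} ↥-eq ↧-eq = ∣-cancel k p∤g (divides ℤ.∣ ↥ z ∣ (begin
      ℤ.∣ ↥ x ∣ ℕ.* ℤ.∣ g ∣            ≡⟨ ℤP.abs-* (↥ x) g ⟨
      ℤ.∣ ↥ x ℤ.* g ∣                  ≡⟨ cong ℤ.∣_∣ ↥-eq ⟩
      ℤ.∣ ↥ (nℚ (p ^ k)) ℤ.* ↥ z ∣     ≡⟨ cong (λ n → ℤ.∣ n ℤ.* ↥ z ∣) (↥-nℚ (p ^ k)) ⟩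
      ℤ.∣ + (p ^ k) ℤ.* ↥ z ∣          ≡⟨ ℤP.abs-* (+ (p ^ k)) (↥ z) ⟩
      p ^ k ℕ.* ℤ.∣ ↥ z ∣              ≡⟨ ℕP.*-comm (p ^ k) _ ⟩
      ℤ.∣ ↥ z ∣ ℕ.* p ^ k              ∎))
      where
      open ≡-Reasoning
      g∣↧z : ℤ.∣ g ∣ ∣ ↧ₙ z
      g∣↧z = abs-∣ g (↧ x) (↧ z) (trans (ℤP.*-comm g (↧ x))
               (trans ↧-eq (trans (cong (ℤ._* ↧ z) (↧-nℚ (p ^ k))) (ℤP.*-identityˡ (↧ z)))))
      p∤g : ¬ p ∣ ℤ.∣ g ∣
      p∤g p∣g = p∤↧z (∣-trans p∣g g∣↧z)

-- Reciprocals a = 1/A and b = 1/B of two quantities with A + B = P.  Taking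
-- A = j and B = p − j, these identities say 1/j + 1/(p−j) ≡ 0, 1/(j(p−j)) ≡ −1/j²
-- and 1/(p−j)² ≡ 1/j², each up to an explicit multiple of p.
record ReciprocalPair (a b P : ℚ) : Set where
  field
    A B : ℚ
    a-inverse : a * A ≡ 1ℚ
    b-inverse : b * B ≡ 1ℚ
    total : A + B ≡ P

module _ {a b P : ℚ} (pair : ReciprocalPair a b P) where
  open ReciprocalPair pair
  open ≡-Reasoning

  pair-sum : a + b ≡ P * (a * b)
  pair-sum = begin
    a + b                      ≡⟨ solve 2 (λ a b → a :+ b := b :* con 1ℚ :+ a :* con 1ℚ) refl a b ⟩
    b * 1ℚ + a * 1ℚ            ≡⟨ cong₂ (λ s t → b * s + a * t) a-inverse b-inverse ⟨
    b * (a * A) + a * (b * B)  ≡⟨ solve 4 (λ a b A B → b :* (a :* A) :+ a :* (b :* B) := (A :+ B) :* (a :* b)) refl a b A B ⟩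
    (A + B) * (a * b)          ≡⟨ cong (_* (a * b)) total ⟩
    P * (a * b)                ∎

  pair-product : a * b ≡ - (a * a) + P * (a * a * b)
  pair-product = begin
    a * b                                  ≡⟨ solve 2 (λ a b → a :* b := a :* b :* con 1ℚ :- a :* a :* con 1ℚ :+ a :* a :* con 1ℚ) refl a b ⟩
    a * b * 1ℚ - a * a * 1ℚ + a * a * 1ℚ   ≡⟨ cong₂ (λ s t → a * b * s - a * a * 1ℚ + a * a * t) a-inverse b-inverse ⟨
    a * b * (a * A) - a * a * 1ℚ + a * a * (b * B)
                                           ≡⟨ solve 4 (λ a b A B → a :* b :* (a :* A) :- a :* a :* con 1ℚ :+ a :* a :* (b :* B)
                                                                  := :- (a :* a) :+ (A :+ B) :* (a :* a :* b)) refl a b A B ⟩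
    - (a * a) + (A + B) * (a * a * b)      ≡⟨ cong (λ s → - (a * a) + s * (a * a * b)) total ⟩
    - (a * a) + P * (a * a * b)            ∎

  pair-square : b * b ≡ a * a + P * (a * b * (b - a))
  pair-square = begin
    b * b                          ≡⟨ solve 2 (λ a b → b :* b := a :* a :+ (a :+ b) :* (b :- a)) refl a b ⟩
    a * a + (a + b) * (b - a)      ≡⟨ cong (λ s → a * a + s * (b - a)) pair-sum ⟩
    a * a + P * (a * b) * (b - a)  ≡⟨ solve 4 (λ a b P c → a :* a :+ P :* c :* (b :- a) := a :* a :+ P :* (c :* (b :- a))) refl a b P (a * b) ⟩
    a * a + P * (a * b * (b - a))  ∎

recip-double : ∀ {a b A} → a * (A + A) ≡ 1ℚ → b * A ≡ 1ℚ → a ≡ recip 2 * b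
recip-double {a} {b} {A} a-inverse b-inverse = begin
  a                                         ≡⟨ solve 3 (λ a b A → a := con ½ :* b :* (a :* (A :+ A)) :+ a :* (con 1ℚ :- b :* A)) refl a b A ⟩
  ½ * b * (a * (A + A)) + a * (1ℚ - b * A)  ≡⟨ cong₂ (λ s t → ½ * b * s + a * (1ℚ - t)) a-inverse b-inverse ⟩
  ½ * b * 1ℚ + a * (1ℚ - 1ℚ)                ≡⟨ solve 2 (λ a b → con ½ :* b :* con 1ℚ :+ a :* (con 1ℚ :- con 1ℚ) := con ½ :* b) refl a b ⟩
  ½ * b                                     ∎
  where
  open ≡-Reasoning
  ½ : ℚ
  ½ = recip 2

module Wolstenholme (m : ℕ) (p-prime : Prime (suc (m ℕ.+ m))) (p>3 : suc (m ℕ.+ m) > 3) where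
  open Integrality p-prime
  open ≡-Reasoning

  N : ℕ
  N = m ℕ.+ m

  P : ℚ
  P = nℚ (suc N)

  -- For 1 ≤ j = k + 1 ≤ N, the reciprocals of j and of its complement p − j = N − k.
  complementary : ∀ k → k ℕ.< N → ReciprocalPair (recip (suc k)) (recip (N ∸ k)) P
  complementary k k<N = record
    { A = nℚ (suc k)
    ; B = nℚ (N ∸ k)
    ; a-inverse = recip-inverse (suc k)
    ; b-inverse = recip-inverse (N ∸ k) {{ℕ.>-nonZero (ℕP.m<n⇒0<n∸m k<N)}}
    ; total = trans (sym (nℚ-+ (suc k) (N ∸ k))) (cong (nℚ ∘ suc) (ℕP.m+[n∸m]≡n (ℕP.<⇒≤ k<N)))
    }

  integral-complementary : ∀ k → k ℕ.< N → Integral (recip (suc k)) × Integral (recip (N ∸ k))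
  integral-complementary k k<N = integral-recip (suc k) (s≤s k<N) , integral-recip (N ∸ k) (s≤s (ℕP.m∸n≤m N k))

  k<m⇒k<N : ∀ {k} → k ℕ.< m → k ℕ.< N
  k<m⇒k<N k<m = ℕP.<-≤-trans k<m (ℕP.m≤m+n m m)

  square cross : ℕ → ℚ
  square j = recip j * recip j
  -- the correction in 1/(p − j)² = 1/j² + p · cross j
  cross j = recip j * recip (suc N ∸ j) * (recip (suc N ∸ j) - recip j)

  integral-cross : ∀ k → k ℕ.< N → Integral (cross (suc k))
  integral-cross k k<N = let (a , b) = integral-complementary k k<N in
    integral-* (integral-* a b) (integral-+ b (integral-neg a))

  reflected-square : ∀ k → k ℕ.< N → square (N ∸ k) ≡ square (suc k) + P * cross (suc k)
  reflected-square k k<N = pair-square (complementary k k<N)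

  T V : ℚ
  T = sumFrom1 N square
  V = sumFrom1 m square

  Y-halves : ℚ
  Y-halves = sumFrom1 m cross

  T-halves : T ≡ V + (V + P * Y-halves)
  T-halves = begin
    T                                          ≡⟨ sum-halves m square ⟩
    V + sumFrom1 m (λ j → square (suc N ∸ j))  ≡⟨ cong (_+_ V) (sum-linear m P (λ k k<m → reflected-square k (k<m⇒k<N k<m))) ⟩
    V + (V + P * Y-halves)                     ∎

  -- Splitting T into even terms 1/(2j)² = ¼·1/j² and odd terms, the complements
  -- of the even ones: T = ¼V + ¼V + p·Y_parity.
  ¼ : ℚ
  ¼ = recip 2 * recip 2

  Y-parity : ℚ
  Y-parity = sumFrom1 m (λ j → cross (j ℕ.+ j))

  -- the even index 2(k + 1) = (k + (k + 1)) + 1 lies in 1..N when k < m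
  even<p : ∀ {k} → k ℕ.< m → k ℕ.+ suc k ℕ.< N
  even<p k<m = ℕP.+-mono-≤ k<m k<m

  even-squares : sumFrom1 m (λ j → square (j ℕ.+ j)) ≡ ¼ * V
  even-squares = trans (sum-cong m quartered) (sum-scale m ¼ square)
    where
    quartered : ∀ k → k ℕ.< m → square (suc k ℕ.+ suc k) ≡ ¼ * square (suc k)
    quartered k _ = begin
      recip j₂ * recip j₂                            ≡⟨ cong (λ r → r * r) halved ⟩
      (recip 2 * recip j) * (recip 2 * recip j)      ≡⟨ solve 2 (λ h r → (h :* r) :* (h :* r) := h :* h :* (r :* r)) refl (recip 2) (recip j) ⟩
      ¼ * square j                                   ∎
      where
      j j₂ : ℕ
      j = suc k
      j₂ = j ℕ.+ j
      halved : recip j₂ ≡ recip 2 * recip j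
      halved = recip-double {b = recip j} {A = nℚ j} (trans (cong (recip j₂ *_) (sym (nℚ-+ j j))) (recip-inverse j₂)) (recip-inverse j)

  T-parity : T ≡ ¼ * V + (¼ * V + P * Y-parity)
  T-parity = begin
    T                                                      ≡⟨ sum-parity m square ⟩
    Evens + sumFrom1 m (λ j → square (suc N ∸ (j ℕ.+ j)))  ≡⟨ cong (_+_ Evens) (sum-linear m P (λ k k<m → reflected-square (k ℕ.+ suc k) (even<p k<m))) ⟩
    Evens + (Evens + P * Y-parity)                         ≡⟨ cong (λ e → e + (e + P * Y-parity)) even-squares ⟩
    ¼ * V + (¼ * V + P * Y-parity)                         ∎
    where
    Evens : ℚ
    Evens = sumFrom1 m (λ j → square (j ℕ.+ j))

  -- Eliminating V between the two decompositions (2V ≡ V/2, so V ≡ 0 as p ≠ 3).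
  Y-T : ℚ
  Y-T = recip 3 * (nℚ 4 * Y-parity - Y-halves)

  T-multiple : T ≡ P * Y-T
  T-multiple = begin
    T                                   ≡⟨ solve 1 (λ t → t := con (nℚ 4 * recip 3) :* t :- con (recip 3) :* t) refl T ⟩
    nℚ 4 * recip 3 * T - recip 3 * T    ≡⟨ cong₂ (λ s t → nℚ 4 * recip 3 * s - recip 3 * t) T-parity T-halves ⟩
    nℚ 4 * recip 3 * (¼ * V + (¼ * V + P * Y-parity)) - recip 3 * (V + (V + P * Y-halves))
                                        ≡⟨ solve 4 (λ v P y y′ →
                                             con (nℚ 4 * recip 3) :* (con ¼ :* v :+ (con ¼ :* v :+ P :* y))
                                               :- con (recip 3) :* (v :+ (v :+ P :* y′))
                                             := P :* (con (recip 3) :* (con (nℚ 4) :* y :- y′))) refl V P Y-parity Y-halves ⟩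
    P * Y-T                             ∎

  -- Pairing j with p − j in H: 2H = p · Σ 1/(j(p−j)) = p(−T + p·Y₁).
  Y₁ : ℚ
  Y₁ = sumFrom1 N (λ j → square j * recip (suc N ∸ j))

  H-double : H N + H N ≡ P * (- T + P * Y₁)
  H-double = begin
    H N + H N                                              ≡⟨ cong₂ _+_ (H-as-sum N) (trans (H-as-sum N) (sum-reverse N recip)) ⟩
    sumFrom1 N recip + sumFrom1 N (λ j → recip (suc N ∸ j)) ≡⟨ sum-+ N recip _ ⟨
    sumFrom1 N (λ j → recip j + recip (suc N ∸ j))          ≡⟨ sum-cong N (λ k k<N → pair-sum (complementary k k<N)) ⟩
    sumFrom1 N (λ j → P * (recip j * recip (suc N ∸ j)))    ≡⟨ sum-scale N P _ ⟩
    P * sumFrom1 N (λ j → recip j * recip (suc N ∸ j))      ≡⟨ cong (P *_) (sum-linear N P (λ k k<N → pair-product (complementary k k<N))) ⟩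
    P * (sumFrom1 N (λ j → - square j) + P * Y₁)            ≡⟨ cong (λ s → P * (s + P * Y₁)) (sum-neg N square) ⟩
    P * (- T + P * Y₁)                                      ∎

  Y : ℚ
  Y = recip 2 * (Y₁ - Y-T)

  wolstenholme : H N ≡ P * (P * Y)
  wolstenholme = begin
    H N                                                 ≡⟨ solve 1 (λ h → h := con (recip 2) :* (h :+ h)) refl (H N) ⟩
    recip 2 * (H N + H N)                               ≡⟨ cong (recip 2 *_) H-double ⟩
    recip 2 * (P * (- T + P * Y₁))                      ≡⟨ cong (λ t → recip 2 * (P * (- t + P * Y₁))) T-multiple ⟩
    recip 2 * (P * (- (P * Y-T) + P * Y₁))              ≡⟨ solve 4 (λ P y y₁ h → h :* (P :* (:- (P :* y) :+ P :* y₁)) := P :* (P :* (h :* (y₁ :- y)))) refl P Y-T Y₁ (recip 2) ⟩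
    P * (P * Y)                                         ∎

  integral-Y : Integral Y
  integral-Y = integral-* (recip< 2 (ℕP.n≤1+n 2)) (integral-+ integral-Y₁ (integral-neg integral-Y-T))
    where
    recip< : ∀ n → n ℕ.≤ 3 → Integral (recip n)
    recip< n n≤3 = integral-recip n (ℕP.≤-<-trans n≤3 p>3)
    integral-Y₁ : Integral Y₁
    integral-Y₁ = integral-sum N λ k k<N → let (a , b) = integral-complementary k k<N in
      integral-* (integral-* a a) b
    integral-Y-T : Integral Y-T
    integral-Y-T = integral-* (recip< 3 ℕP.≤-refl)
      (integral-+ (integral-* (integral-nℚ 4) (integral-sum m λ k k<m → integral-cross (k ℕ.+ suc k) (even<p k<m)))
                  (integral-neg (integral-sum m λ k k<m → integral-cross k (k<m⇒k<N k<m))))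

claimed : ℚ → ℚ
claimed P = (+ 5743) / 27000 * P - (+ 7) / 225

Congruence : ℕ → Set
Congruence p = sumFrom1 (p ∸ 1) k⁴H² ≡ℚ claimed (nℚ p) [mod p ^ 2 ]

-- Substituting h = P²·Y with P = n + 1 into the closed form, the difference with
-- the claimed value is P²·Z(n, Y) for the polynomial Z below.
rCoeffs : List ℚ
rCoeffs = - (+ 4903 / 27000) ∷ + 382 / 3375 ∷ - (+ 109 / 2000) ∷ + 2 / 125 ∷ []

Z : ℚ → ℚ → ℚ
Z n Y = horner aCoeffs n * ((n + 1ℚ) * (n + 1ℚ) * Y * Y) + horner bCoeffs n * Y + horner rCoeffs n

excess-identity : ∀ n Y →
  closedForm n ((n + 1ℚ) * ((n + 1ℚ) * Y)) - claimed (n + 1ℚ) ≡ (n + 1ℚ) * ((n + 1ℚ) * Z n Y)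
excess-identity = solve 2 (λ n Y →
  closedFormS n ((n :+ con 1ℚ) :* ((n :+ con 1ℚ) :* Y)) :- (con ((+ 5743) / 27000) :* (n :+ con 1ℚ) :- con ((+ 7) / 225))
    := (n :+ con 1ℚ) :* ((n :+ con 1ℚ) :* (hornerS aCoeffs n :* ((n :+ con 1ℚ) :* (n :+ con 1ℚ) :* Y :* Y)
                                           :+ hornerS bCoeffs n :* Y :+ hornerS rCoeffs n))) refl

30-smooth : (cs : List ℚ) → {True (all? (λ c → ↧ₙ c ∣? 30 ^ 6) cs)} → All (λ c → ↧ₙ c ∣ 30 ^ 6) cs
30-smooth cs {smooth} = toWitness smooth

even-or-odd : ∀ n → Σ ℕ λ m → n ≡ m ℕ.+ m ⊎ n ≡ suc (m ℕ.+ m)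
even-or-odd zero = 0 , inj₁ refl
even-or-odd (suc n) with even-or-odd n
... | m , inj₁ refl = m , inj₂ refl
... | m , inj₂ refl = suc m , inj₁ (cong suc (sym (ℕP.+-suc m m)))

odd-prime : ∀ {p} → Prime p → p > 2 → Σ ℕ λ m → p ≡ suc (m ℕ.+ m)
odd-prime {p} p-prime p>2 with even-or-odd p
... | m , inj₂ odd = m , odd
... | m , inj₁ refl = ⊥-elim ([ (λ ()) , ℕP.<⇒≢ p>2 ]′ (prime⇒irreducible p-prime 2∣p))
  where
  2∣p : 2 ∣ m ℕ.+ m
  2∣p = divides m (sym (trans (ℕP.*-suc m 1) (cong (m ℕ.+_) (ℕP.*-identityʳ m))))

module Corollary (m : ℕ) (p-prime : Prime (suc (m ℕ.+ m))) (p>5 : suc (m ℕ.+ m) > 5) where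
  open Integrality p-prime
  open Wolstenholme m p-prime (ℕP.<-trans (s≤s (s≤s (s≤s (s≤s z≤n)))) p>5)

  n : ℚ
  n = nℚ N

  integral-Z : Integral (Z n Y)
  integral-Z = integral-+ (integral-+ (integral-* (integral-poly aCoeffs) integral-P²Y²)
                                      (integral-* (integral-poly bCoeffs) integral-Y))
                          (integral-poly rCoeffs)
    where
    integral-P : Integral (n + 1ℚ)
    integral-P = integral-+ (integral-nℚ N) (integral-nℚ 1)
    integral-P²Y² : Integral ((n + 1ℚ) * (n + 1ℚ) * Y * Y)
    integral-P²Y² = integral-* (integral-* (integral-* integral-P integral-P) integral-Y) integral-Y
    integral-poly : (cs : List ℚ) → {True (all? (λ c → ↧ₙ c ∣? 30 ^ 6) cs)} → Integral (horner cs n)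
    integral-poly cs {smooth} = integral-horner (All.map (λ {c} → integral-30-smooth p>5 {6} c) (30-smooth cs {smooth})) (integral-nℚ N)

  excess : sumFrom1 N k⁴H² - claimed P ≡ nℚ (suc N ^ 2) * Z n Y
  excess = begin
    sumFrom1 N k⁴H² - claimed P                         ≡⟨ cong (λ s → s - claimed P) (sum-k⁴H² N) ⟩
    closedForm n (H N) - claimed P                      ≡⟨ cong (λ h → closedForm n h - claimed P) wolstenholme ⟩
    closedForm n (P * (P * Y)) - claimed P              ≡⟨ cong (λ w → closedForm n (w * (w * Y)) - claimed w) (nℚ-suc N) ⟩
    closedForm n ((n + 1ℚ) * ((n + 1ℚ) * Y)) - claimed (n + 1ℚ)
                                                        ≡⟨ excess-identity n Y ⟩
    (n + 1ℚ) * ((n + 1ℚ) * Z n Y)                       ≡⟨ cong (λ w → w * (w * Z n Y)) (nℚ-suc N) ⟨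
    P * (P * Z n Y)                                     ≡⟨ nℚ-square (suc N) (Z n Y) ⟩
    nℚ (suc N ^ 2) * Z n Y                              ∎
    where open ≡-Reasoning

  congruence : Congruence (suc N)
  congruence = subst (λ x → suc N ^ 2 ∣ ℤ.∣ ↥ x ∣) (sym excess) (p^k∣numerator 2 integral-Z)

corollary3p5 : (p : ℕ) → Prime p → p > 5 →
    sumFrom1 (p ∸ 1) (λ k → nℚ k * nℚ k * nℚ k * nℚ k * H k * H k)
      ≡ℚ ((+ 5743) / 27000 * nℚ p - (+ 7) / 225) [mod p ^ 2 ]
corollary3p5 p p-prime p>5 = subst Congruence (sym p≡2m+1)
  (Corollary.congruence m (subst Prime p≡2m+1 p-prime) (subst (_> 5) p≡2m+1 p>5))
  where
  odd : Σ ℕ λ m → p ≡ suc (m ℕ.+ m)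
  odd = odd-prime p-prime (ℕP.<-trans (s≤s (s≤s (s≤s z≤n))) p>5)
  m : ℕ
  m = proj₁ odd
  p≡2m+1 : p ≡ suc (m ℕ.+ m)
  p≡2m+1 = proj₂ odd
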